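{- Every $q$-Gauss sequence is a $q$-Euler–Gauss sequence: if $(a_n(q))_{n\ge1}$ is a sequence in $\mathbb{Z}[q]$ with $\sum_{d\mid n}\mu(d)\,a_{n/d}(q^d)\equiv 0\pmod{[n]_q}$ for all $n\ge1$, then for all $n\ge1$, $\prod_{d\mid n,\ \mu(d)=1} a_{n/d}(q^d)\equiv \prod_{d\mid n,\ \mu(d)=-1} a_{n/d}(q^d)\pmod{[n]_q}$.
   Context: $\mu$ is the Möbius function, $[n]_q=1+q+\cdots+q^{n-1}$, and congruence modulo $[n]_q$ means the difference is divisible by $[n]_q$ in $\mathbb{Z}[q]$. Empty products equal $1$. -}

module Defs where

open import Data.Nat as ℕ using (ℕ; zero; suc; _≥_)
open import Data.Nat.Divisibility using (_∣_; _∣?_)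
open import Data.Nat.DivMod using (_/_)
open import Data.Nat.Primality using (prime?)
open import Data.Integer as ℤ using (ℤ; +_; -_)
open import Data.List using (List; []; _∷_; _++_; replicate; filter; upTo; map; foldr; length)
open import Data.Bool using (Bool; true; false; if_then_else_; _∧_)
open import Data.Product using (Σ; _×_)
open import Relation.Nullary using (¬_; does)
open import Relation.Nullary.Decidable using (_×-dec_; ¬?)
open import Relation.Binary.PropositionalEquality using (_≡_)

-- Polynomials in ℤ[q] as coefficient lists (constant term first).
-- Equality of polynomials is coefficientwise (trailing zeros ignored).

Poly : Set
Poly = List ℤ

coeff : Poly → ℕ → ℤ
coeff []       _       = + 0
coeff (c ∷ cs) zero    = c
coeff (c ∷ cs) (suc k) = coeff cs k

_≈ₚ_ : Poly → Poly → Set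
p ≈ₚ r = ∀ k → coeff p k ≡ coeff r k

infixl 6 _+ₚ_ _-ₚ_
infixl 7 _*ₚ_ _·ₚ_

_+ₚ_ : Poly → Poly → Poly
[]       +ₚ r        = r
(c ∷ cs) +ₚ []       = c ∷ cs
(c ∷ cs) +ₚ (d ∷ ds) = (c ℤ.+ d) ∷ (cs +ₚ ds)

_·ₚ_ : ℤ → Poly → Poly
a ·ₚ p = map (a ℤ.*_) p

_-ₚ_ : Poly → Poly → Poly
p -ₚ r = p +ₚ ((- + 1) ·ₚ r)

_*ₚ_ : Poly → Poly → Poly
[]       *ₚ r = []
(c ∷ cs) *ₚ r = (c ·ₚ r) +ₚ (+ 0 ∷ (cs *ₚ r))

oneₚ : Poly
oneₚ = + 1 ∷ []

zeroₚ : Poly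
zeroₚ = []

sumₚ : List Poly → Poly
sumₚ = foldr _+ₚ_ zeroₚ

prodₚ : List Poly → Poly
prodₚ = foldr _*ₚ_ oneₚ

-- substitution q ↦ q^(suc k):  p(q) ↦ p(q^(suc k))
dilate : ℕ → Poly → Poly
dilate k []       = []
dilate k (c ∷ []) = c ∷ []
dilate k (c ∷ cs) = c ∷ (replicate k (+ 0) ++ dilate k cs)

qInt : ℕ → Poly
qInt n = replicate n (+ 1)

_∣ₚ_ : Poly → Poly → Set
m ∣ₚ f = Σ Poly (λ h → (m *ₚ h) ≈ₚ f)

_≡_[modₚ_] : Poly → Poly → Poly → Set
f ≡ g [modₚ m ] = m ∣ₚ (f -ₚ g)

primeDivisors : ℕ → List ℕ
primeDivisors n = filter (λ p → prime? p ×-dec (p ∣? n)) (upTo (suc n))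

squarefree : ℕ → Bool
squarefree n = foldr (λ p b → does (¬? ((p ℕ.* p) ∣? n)) ∧ b) true (primeDivisors n)

negOnePow : ℕ → ℤ
negOnePow zero    = + 1
negOnePow (suc k) = - negOnePow k

μ : ℕ → ℤ
μ n = if squarefree n then negOnePow (length (primeDivisors n)) else + 0

-- Divisors of n, listed as k with d = suc k (so that d ≠ 0 definitionally).

divisorsPred : ℕ → List ℕ
divisorsPred n = filter (λ k → suc k ∣? n) (upTo n)

-- the term a_{n/d}(q^d) for d = suc k
term : (ℕ → Poly) → ℕ → ℕ → Poly
term a n k = dilate k (a (n / suc k))

gaussSum : (ℕ → Poly) → ℕ → Poly
gaussSum a n = sumₚ (map (λ k → μ (suc k) ·ₚ term a n k) (divisorsPred n))

eulerProd : ℤ → (ℕ → Poly) → ℕ → Poly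
eulerProd s a n =
  prodₚ (map (term a n) (filter (λ k → μ (suc k) ℤ.≟ s) (divisorsPred n)))

-- q-Gauss sequence (indexed from 1; a 0 is irrelevant)
IsQGauss : (ℕ → Poly) → Set
IsQGauss a = ∀ n → n ≥ 1 → gaussSum a n ≡ zeroₚ [modₚ qInt n ]

IsQEulerGauss : (ℕ → Poly) → Set
IsQEulerGauss a = ∀ n → n ≥ 1 →
  eulerProd (+ 1) a n ≡ eulerProd (- + 1) a n [modₚ qInt n ]

-- Fix a prime p and write n = p^(w+1) m with p ∤ m.  For N = p^(w+1) m′ with p ∤ m′,
-- the squarefree divisors of N are the squarefree d ∣ m′ together with the p d, and
-- μ(p d) = -μ(d).  So the Gauss sum at N is a sum of pairs
-- μ(d) (a_{N/d}(q^d) - a_{N/(p d)}(q^(p d))); by induction on m′ every pair with d > 1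
-- vanishes modulo [p^(w+1)]_{q^m′}, and the pair d = 1 gives the Gauss congruence
-- a_{p^(w+1) m′}(q) ≡ a_{p^w m′}(q^p) modulo [p^(w+1)]_{q^m′}.  Dilated by q ↦ q^d it
-- says that the factor of index p d in one Euler product at n agrees with the factor of
-- index d in the other, modulo [p^(w+1)]_{q^m}; hence [n] = [m] [p^(w+1)]_{q^m} divides
-- [m] (E₊ - E₋).  The set of u with [n] ∣ [u] (E₊ - E₋) is closed under gcd, because
-- [gcd(u, v)] is a ℤ[q]-combination of [u] and [v], and it contains, for every prime p,
-- a number prime to p.  Hence it contains 1.

module Submission where

open import Level using (_⊔_)
open import Algebra.Bundles using (CommutativeRing)
open import Data.List using (List; []; _∷_; map; foldr; _++_)
import Data.List.Properties as List
open import Data.List.Relation.Binary.Permutation.Propositional using (_↭_; ↭⇒↭ₛ′)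
open import Data.List.Relation.Binary.Permutation.Propositional.Properties using (map⁺)
open import Data.List.Relation.Binary.Permutation.Setoid.Properties using (foldr-commMonoid)
open import Data.List.Relation.Unary.All as All using (All; []; _∷_)
open import Function using (_∘_)
open import Relation.Binary.PropositionalEquality as ≡ using (_≡_; cong)

-- Congruences in a commutative ring

module Congruence {c ℓ} (R : CommutativeRing c ℓ) where

  open CommutativeRing R
  open import Algebra.Properties.Ring ring
    using (-‿distribˡ-*; ⁻¹-anti-homo‿-; x[y-z]≈xy-xz; x≈y⇒x∙y⁻¹≈ε; xyx⁻¹≈y)
  open import Algebra.Properties.Semiring.Divisibility semiring public
    using (_∣_; ∣ʳ-trans; ∣ʳ-reflexive; ∣ʳ-respʳ-≈; ∣ʳ-respˡ-≈; x∣ʳyx; x∣ʳy⇒x∣ʳzy)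
  open import Algebra.Properties.Semiring.Divisibility semiring using (_∣0)
  open import Algebra.Properties.CommutativeSemigroup.Divisibility *-commutativeSemigroup public
    using (x∣y⇒zx∣zy)
  open import Algebra.Properties.CommutativeSemigroup +-commutativeSemigroup using (interchange)
  open import Algebra.Definitions.RawMagma *-rawMagma public using (_,_)
  open import Relation.Binary.Reasoning.Setoid setoid

  ∣-+ : ∀ {m x y} → m ∣ x → m ∣ y → m ∣ x + y
  ∣-+ {m} (a , am≈x) (b , bm≈y) = a + b , trans (distribʳ m a b) (+-cong am≈x bm≈y)

  ∣-neg : ∀ {m x} → m ∣ x → m ∣ - x
  ∣-neg {m} (a , am≈x) = - a , trans (sym (-‿distribˡ-* a m)) (-‿cong am≈x)

  ∣-+-cancelˡ : ∀ {m x y} → m ∣ y + x → m ∣ y → m ∣ x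
  ∣-+-cancelˡ {x = x} {y} m∣y+x m∣y = ∣ʳ-respʳ-≈ (xyx⁻¹≈y y x) (∣-+ m∣y+x (∣-neg m∣y))

  ∣-+-cancelʳ : ∀ {m x y} → m ∣ x + y → m ∣ y → m ∣ x
  ∣-+-cancelʳ {x = x} {y} m∣x+y = ∣-+-cancelˡ (∣ʳ-respʳ-≈ (+-comm x y) m∣x+y)

  x-y+y-z≈x-z : ∀ x y z → (x - y) + (y - z) ≈ x - z
  x-y+y-z≈x-z x y z = begin
    (x - y) + (y - z)   ≈⟨ +-assoc x (- y) (y - z) ⟩
    x + (- y + (y - z)) ≈⟨ +-congˡ (+-assoc (- y) y (- z)) ⟨
    x + ((- y + y) - z) ≈⟨ +-congˡ (+-congʳ (-‿inverseˡ y)) ⟩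
    x + (0# - z)        ≈⟨ +-congˡ (+-identityˡ (- z)) ⟩
    x - z               ∎

  infix 4 _≡_[mod_]
  record _≡_[mod_] (x y m : Carrier) : Set (c ⊔ ℓ) where
    constructor ≡-mod
    field ∣-difference : m ∣ x - y
  open _≡_[mod_] public

  ≈⇒≡-mod : ∀ {m x y} → x ≈ y → x ≡ y [mod m ]
  ≈⇒≡-mod {m} x≈y = ≡-mod (∣ʳ-respʳ-≈ (sym (x≈y⇒x∙y⁻¹≈ε x≈y)) (m ∣0))

  ≡-mod-refl : ∀ {m x} → x ≡ x [mod m ]
  ≡-mod-refl = ≈⇒≡-mod refl

  ≡-mod-sym : ∀ {m x y} → x ≡ y [mod m ] → y ≡ x [mod m ]
  ≡-mod-sym {x = x} {y} (≡-mod m∣x-y) = ≡-mod (∣ʳ-respʳ-≈ (⁻¹-anti-homo‿- x y) (∣-neg m∣x-y))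

  ≡-mod-trans : ∀ {m x y z} → x ≡ y [mod m ] → y ≡ z [mod m ] → x ≡ z [mod m ]
  ≡-mod-trans {x = x} {y} {z} (≡-mod m∣x-y) (≡-mod m∣y-z) =
    ≡-mod (∣ʳ-respʳ-≈ (x-y+y-z≈x-z x y z) (∣-+ m∣x-y m∣y-z))

  ≡-mod-respʳ : ∀ {m x y y′} → y ≈ y′ → x ≡ y [mod m ] → x ≡ y′ [mod m ]
  ≡-mod-respʳ y≈y′ x≡y = ≡-mod-trans x≡y (≈⇒≡-mod y≈y′)

  ≡-mod-respˡ : ∀ {m x x′ y} → x ≈ x′ → x ≡ y [mod m ] → x′ ≡ y [mod m ]
  ≡-mod-respˡ x≈x′ x≡y = ≡-mod-trans (≈⇒≡-mod (sym x≈x′)) x≡y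

  ≡-mod-* : ∀ {m x x′ y y′} → x ≡ x′ [mod m ] → y ≡ y′ [mod m ] → x * y ≡ x′ * y′ [mod m ]
  ≡-mod-* {x = x} {x′} {y} {y′} (≡-mod m∣x-x′) (≡-mod m∣y-y′) =
    ≡-mod (∣ʳ-respʳ-≈ eq (∣-+ (x∣ʳy⇒x∣ʳzy y m∣x-x′) (x∣ʳy⇒x∣ʳzy x′ m∣y-y′)))
    where
    eq : y * (x - x′) + x′ * (y - y′) ≈ x * y - x′ * y′
    eq = begin
      y * (x - x′) + x′ * (y - y′)          ≈⟨ +-cong (x[y-z]≈xy-xz y x x′) (x[y-z]≈xy-xz x′ y y′) ⟩
      (y * x - y * x′) + (x′ * y - x′ * y′) ≈⟨ +-congʳ (+-cong (*-comm y x) (-‿cong (*-comm y x′))) ⟩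
      (x * y - x′ * y) + (x′ * y - x′ * y′) ≈⟨ x-y+y-z≈x-z (x * y) (x′ * y) (x′ * y′) ⟩
      x * y - x′ * y′                       ∎

  ≡-mod-∣ : ∀ {m m′ x y} → m′ ∣ m → x ≡ y [mod m ] → x ≡ y [mod m′ ]
  ≡-mod-∣ m′∣m (≡-mod m∣x-y) = ≡-mod (∣ʳ-trans m′∣m m∣x-y)

  ∑ : ∀ {a} {A : Set a} → (A → Carrier) → List A → Carrier
  ∑ f xs = foldr _+_ 0# (map f xs)

  ∏ : ∀ {a} {A : Set a} → (A → Carrier) → List A → Carrier
  ∏ f xs = foldr _*_ 1# (map f xs)

  module _ {a} {A : Set a} where

    ∣-∑ : ∀ {m} (f : A → Carrier) {xs} → All (λ x → m ∣ f x) xs → m ∣ ∑ f xs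
    ∣-∑ {m} f []             = m ∣0
    ∣-∑     f (m∣fx ∷ m∣fxs) = ∣-+ m∣fx (∣-∑ f m∣fxs)

    ∑-cong : ∀ {f g : A → Carrier} {xs} → All (λ x → f x ≈ g x) xs → ∑ f xs ≈ ∑ g xs
    ∑-cong []                = refl
    ∑-cong (fx≈gx ∷ fxs≈gxs) = +-cong fx≈gx (∑-cong fxs≈gxs)

    ∏-≡-mod : ∀ {m} (f g : A → Carrier) {xs} → All (λ x → f x ≡ g x [mod m ]) xs → ∏ f xs ≡ ∏ g xs [mod m ]
    ∏-≡-mod f g []                = ≡-mod-refl
    ∏-≡-mod f g (fx≡gx ∷ fxs≡gxs) = ≡-mod-* fx≡gx (∏-≡-mod f g fxs≡gxs)

    ∑-+ : ∀ (f g : A → Carrier) xs → ∑ f xs + ∑ g xs ≈ ∑ (λ x → f x + g x) xs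
    ∑-+ f g []       = +-identityˡ 0#
    ∑-+ f g (x ∷ xs) = begin
      (f x + ∑ f xs) + (g x + ∑ g xs)  ≈⟨ interchange (f x) (∑ f xs) (g x) (∑ g xs) ⟩
      (f x + g x) + (∑ f xs + ∑ g xs)  ≈⟨ +-congˡ (∑-+ f g xs) ⟩
      (f x + g x) + ∑ (λ x → f x + g x) xs ∎

    ∑-map : ∀ {b} {B : Set b} (f : B → Carrier) (h : A → B) xs → ∑ f (map h xs) ≡ ∑ (f ∘ h) xs
    ∑-map f h xs = cong (foldr _+_ 0#) (≡.sym (List.map-∘ xs))

    ∏-map : ∀ {b} {B : Set b} (f : B → Carrier) (h : A → B) xs → ∏ f (map h xs) ≡ ∏ (f ∘ h) xs
    ∏-map f h xs = cong (foldr _*_ 1#) (≡.sym (List.map-∘ xs))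

    ∑-++ : ∀ (f : A → Carrier) xs ys → ∑ f (xs ++ ys) ≈ ∑ f xs + ∑ f ys
    ∑-++ f []       ys = sym (+-identityˡ (∑ f ys))
    ∑-++ f (x ∷ xs) ys = trans (+-congˡ (∑-++ f xs ys)) (sym (+-assoc (f x) (∑ f xs) (∑ f ys)))

    ∏-++ : ∀ (f : A → Carrier) xs ys → ∏ f (xs ++ ys) ≈ ∏ f xs * ∏ f ys
    ∏-++ f []       ys = sym (*-identityˡ (∏ f ys))
    ∏-++ f (x ∷ xs) ys = trans (*-congˡ (∏-++ f xs ys)) (sym (*-assoc (f x) (∏ f xs) (∏ f ys)))

    ∑-↭ : ∀ (f : A → Carrier) {xs ys} → xs ↭ ys → ∑ f xs ≈ ∑ f ys
    ∑-↭ f xs↭ys = foldr-commMonoid setoid +-isCommutativeMonoid (↭⇒↭ₛ′ isEquivalence (map⁺ f xs↭ys))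

    ∏-↭ : ∀ (f : A → Carrier) {xs ys} → xs ↭ ys → ∏ f xs ≈ ∏ f ys
    ∏-↭ f xs↭ys = foldr-commMonoid setoid *-isCommutativeMonoid (↭⇒↭ₛ′ isEquivalence (map⁺ f xs↭ys))

open import Level using (0ℓ)
open import Function using (case_of_)
open import Data.List using (replicate; filter; upTo; applyUpTo; length)
open import Data.List.Relation.Binary.Permutation.Propositional.Properties using (↭-length)
open import Data.Nat as ℕ using (ℕ; zero; suc; _+_; _*_; _^_; _<_; s≤s; NonZero)
import Data.Nat.Properties as ℕ
open import Data.Nat.Divisibility
open import Data.Nat.DivMod using (_/_; m*n/n≡m)
open import Data.Nat.GCD using (gcd; gcd-GCD; module Bézout; gcd[m,n]∣m; gcd[m,n]∣n; gcd[m,n]≢0)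
open import Data.Nat.Coprimality using (Coprime; coprime-divisor)
open import Data.Nat.Primality using (Prime; prime?; prime⇒nonZero; prime⇒nonTrivial; prime⇒irreducible; euclidsLemma)
open import Data.Nat.Primality.Factorisation using (factorise)
open import Data.Nat.Induction using (<-rec)
open import Data.Nat.Solver using (module +-*-Solver)
open import Data.Integer as ℤ using (ℤ; +_; -_)
import Data.Integer.Properties as ℤ
open import Algebra.Properties.CommutativeSemigroup ℤ.+-commutativeSemigroup
  using () renaming (interchange to ℤ+-interchange)
open import Data.Bool using (Bool; true; false; _∧_)
open import Data.List.Relation.Unary.AllPairs using (_∷_)
open import Data.List.Relation.Unary.Any using (here; there)
open import Data.List.Membership.Propositional using (_∈_)
open import Data.List.Membership.Propositional.Properties
  using (∈-filter⁺; ∈-filter⁻; ∈-upTo⁺; ∈-applyUpTo⁻; ∈-map⁺; ∈-map⁻; ∈-++⁺ˡ; ∈-++⁺ʳ; ∈-++⁻)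
open import Data.List.Membership.Propositional.Properties.WithK using (unique∧set⇒bag)
open import Data.List.Relation.Unary.Unique.Propositional using (Unique)
import Data.List.Relation.Unary.Unique.Propositional.Properties as Unique
open import Data.List.Relation.Binary.BagAndSetEquality using (∼bag⇒↭)
open import Data.Product using (∃-syntax; ∃₂; _×_; _,_; proj₁; proj₂)
open import Data.Sum using (inj₁; inj₂; reduce)
open import Data.Empty using (⊥-elim)
open import Function.Bundles using (_⇔_; mk⇔)
open import Relation.Nullary using (¬_; yes; no; does; Dec)
open import Relation.Nullary.Decidable using (_×-dec_; ¬?)
open import Relation.Unary using (Pred; Decidable)
open import Relation.Binary.PropositionalEquality
  using (_≢_; refl; sym; trans; cong₂; subst; subst₂; module ≡-Reasoning)
open import Relation.Binary.Bundles using (Setoid)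
open import Relation.Binary.Structures using (IsEquivalence)
import Relation.Binary.Reasoning.Setoid as SetoidReasoning
open import Defs

-- The polynomial ring ℤ[q]

-- The coefficientwise equality of Defs, wrapped in a record so that both polynomials
-- can be inferred from a proof.
infix 4 _≈_
record _≈_ (f g : Poly) : Set where
  constructor mk≈
  field coeff-≡ : f ≈ₚ g
open _≈_ public

≈-refl : ∀ {f} → f ≈ f
≈-refl = mk≈ λ _ → refl

≈-sym : ∀ {f g} → f ≈ g → g ≈ f
≈-sym e = mk≈ λ k → sym (coeff-≡ e k)

≈-trans : ∀ {f g h} → f ≈ g → g ≈ h → f ≈ h
≈-trans e e′ = mk≈ λ k → trans (coeff-≡ e k) (coeff-≡ e′ k)

≈-isEquivalence : IsEquivalence _≈_
≈-isEquivalence = record { refl = ≈-refl ; sym = ≈-sym ; trans = ≈-trans }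

≈-setoid : Setoid _ _
≈-setoid = record { isEquivalence = ≈-isEquivalence }

module ≈-Reasoning = SetoidReasoning ≈-setoid

≡⇒≈ : ∀ {f g} → f ≡ g → f ≈ g
≡⇒≈ refl = ≈-refl

∷-cong : ∀ {c d f g} → c ≡ d → f ≈ g → c ∷ f ≈ d ∷ g
∷-cong c≡d f≈g = mk≈ λ where
  zero    → c≡d
  (suc k) → coeff-≡ f≈g k

tail-≈ : ∀ {c d f g} → c ∷ f ≈ d ∷ g → f ≈ g
tail-≈ e = mk≈ λ k → coeff-≡ e (suc k)

coeff-+ : ∀ f g k → coeff (f +ₚ g) k ≡ coeff f k ℤ.+ coeff g k
coeff-+ []       g        k       = sym (ℤ.+-identityˡ (coeff g k))
coeff-+ (c ∷ f)  []       k       = sym (ℤ.+-identityʳ (coeff (c ∷ f) k))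
coeff-+ (c ∷ f)  (d ∷ g)  zero    = refl
coeff-+ (c ∷ f)  (d ∷ g)  (suc k) = coeff-+ f g k

coeff-· : ∀ a f k → coeff (a ·ₚ f) k ≡ a ℤ.* coeff f k
coeff-· a []      k       = sym (ℤ.*-zeroʳ a)
coeff-· a (c ∷ f) zero    = refl
coeff-· a (c ∷ f) (suc k) = coeff-· a f k

negₚ : Poly → Poly
negₚ = (- + 1) ·ₚ_

coeff-neg : ∀ f k → coeff (negₚ f) k ≡ ℤ.- coeff f k
coeff-neg f k = trans (coeff-· (- + 1) f k) (ℤ.-1*i≡-i (coeff f k))

+-cong : ∀ {f f′ g g′} → f ≈ f′ → g ≈ g′ → f +ₚ g ≈ f′ +ₚ g′
+-cong {f} {f′} {g} {g′} e e′ = mk≈ λ k →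
  trans (coeff-+ f g k) (trans (cong₂ ℤ._+_ (coeff-≡ e k) (coeff-≡ e′ k)) (sym (coeff-+ f′ g′ k)))

·-cong : ∀ a {f g} → f ≈ g → a ·ₚ f ≈ a ·ₚ g
·-cong a {f} {g} e = mk≈ λ k →
  trans (coeff-· a f k) (trans (cong (a ℤ.*_) (coeff-≡ e k)) (sym (coeff-· a g k)))

+-assoc : ∀ f g h → (f +ₚ g) +ₚ h ≈ f +ₚ (g +ₚ h)
+-assoc f g h = mk≈ λ k → begin
  coeff ((f +ₚ g) +ₚ h) k                  ≡⟨ trans (coeff-+ (f +ₚ g) h k) (cong (ℤ._+ coeff h k) (coeff-+ f g k)) ⟩
  (coeff f k ℤ.+ coeff g k) ℤ.+ coeff h k  ≡⟨ ℤ.+-assoc (coeff f k) (coeff g k) (coeff h k) ⟩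
  coeff f k ℤ.+ (coeff g k ℤ.+ coeff h k)  ≡⟨ sym (trans (coeff-+ f (g +ₚ h) k)
                                                       (cong (ℤ._+_ (coeff f k)) (coeff-+ g h k))) ⟩
  coeff (f +ₚ (g +ₚ h)) k                  ∎
  where open ≡-Reasoning

+-comm : ∀ f g → f +ₚ g ≈ g +ₚ f
+-comm f g = mk≈ λ k →
  trans (coeff-+ f g k) (trans (ℤ.+-comm (coeff f k) (coeff g k)) (sym (coeff-+ g f k)))

+-identityˡ : ∀ f → zeroₚ +ₚ f ≈ f
+-identityˡ f = ≈-refl

+-identityʳ : ∀ f → f +ₚ zeroₚ ≈ f
+-identityʳ f = mk≈ λ k → trans (coeff-+ f [] k) (ℤ.+-identityʳ (coeff f k))

+-inverseʳ : ∀ f → f +ₚ negₚ f ≈ zeroₚ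
+-inverseʳ f = mk≈ λ k →
  trans (coeff-+ f (negₚ f) k) (trans (cong (ℤ._+_ (coeff f k)) (coeff-neg f k)) (ℤ.+-inverseʳ (coeff f k)))

+-inverseˡ : ∀ f → negₚ f +ₚ f ≈ zeroₚ
+-inverseˡ f = ≈-trans (+-comm (negₚ f) f) (+-inverseʳ f)

·-distrib-+ : ∀ a f g → a ·ₚ (f +ₚ g) ≈ a ·ₚ f +ₚ a ·ₚ g
·-distrib-+ a f g = mk≈ λ k → begin
  coeff (a ·ₚ (f +ₚ g)) k                        ≡⟨ trans (coeff-· a (f +ₚ g) k) (cong (a ℤ.*_) (coeff-+ f g k)) ⟩
  a ℤ.* (coeff f k ℤ.+ coeff g k)                ≡⟨ ℤ.*-distribˡ-+ a (coeff f k) (coeff g k) ⟩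
  a ℤ.* coeff f k ℤ.+ a ℤ.* coeff g k            ≡⟨ sym (trans (coeff-+ (a ·ₚ f) (a ·ₚ g) k)
                                                             (cong₂ ℤ._+_ (coeff-· a f k) (coeff-· a g k))) ⟩
  coeff (a ·ₚ f +ₚ a ·ₚ g) k                     ∎
  where open ≡-Reasoning

·-assoc : ∀ a b f → a ·ₚ (b ·ₚ f) ≈ (a ℤ.* b) ·ₚ f
·-assoc a b f = mk≈ λ k →
  trans (coeff-· a (b ·ₚ f) k) (trans (cong (a ℤ.*_) (coeff-· b f k))
    (trans (sym (ℤ.*-assoc a b (coeff f k))) (sym (coeff-· (a ℤ.* b) f k))))

0·f≈0 : ∀ f → + 0 ·ₚ f ≈ zeroₚ
0·f≈0 f = mk≈ (coeff-· (+ 0) f)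

1·f≈f : ∀ f → + 1 ·ₚ f ≈ f
1·f≈f f = mk≈ λ k → trans (coeff-· (+ 1) f k) (ℤ.*-identityˡ (coeff f k))

+-interchange : ∀ f g h i → (f +ₚ g) +ₚ (h +ₚ i) ≈ (f +ₚ h) +ₚ (g +ₚ i)
+-interchange f g h i = mk≈ λ k → trans (expand f g h i k)
  (trans (ℤ+-interchange (coeff f k) (coeff g k) (coeff h k) (coeff i k)) (sym (expand f h g i k)))
  where
  expand : ∀ f g h i k → coeff ((f +ₚ g) +ₚ (h +ₚ i)) k ≡ (coeff f k ℤ.+ coeff g k) ℤ.+ (coeff h k ℤ.+ coeff i k)
  expand f g h i k = trans (coeff-+ (f +ₚ g) (h +ₚ i) k) (cong₂ ℤ._+_ (coeff-+ f g k) (coeff-+ h i k))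

shift : Poly → Poly
shift f = + 0 ∷ f

shift-cong : ∀ {f g} → f ≈ g → shift f ≈ shift g
shift-cong = ∷-cong refl

shift-zero : shift zeroₚ ≈ zeroₚ
shift-zero = mk≈ λ where
  zero    → refl
  (suc k) → refl

·-shift : ∀ a f → a ·ₚ shift f ≈ shift (a ·ₚ f)
·-shift a f = ∷-cong (ℤ.*-zeroʳ a) ≈-refl

*-congʳ : ∀ f {g g′} → g ≈ g′ → f *ₚ g ≈ f *ₚ g′
*-congʳ []      e = ≈-refl
*-congʳ (c ∷ f) e = +-cong (·-cong c e) (shift-cong (*-congʳ f e))

*-zeroʳ : ∀ f → f *ₚ zeroₚ ≈ zeroₚ
*-zeroʳ []      = ≈-refl
*-zeroʳ (c ∷ f) = ≈-trans (shift-cong (*-zeroʳ f)) shift-zero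

*-∷ʳ : ∀ f c g → f *ₚ (c ∷ g) ≈ c ·ₚ f +ₚ shift (f *ₚ g)
*-∷ʳ []      c g = ≈-sym shift-zero
*-∷ʳ (d ∷ f) c g = ∷-cong d·c≈c·d (begin
  d ·ₚ g +ₚ (f *ₚ (c ∷ g))             ≈⟨ +-cong ≈-refl (*-∷ʳ f c g) ⟩
  d ·ₚ g +ₚ (c ·ₚ f +ₚ shift (f *ₚ g)) ≈⟨ ≈-sym (+-assoc (d ·ₚ g) (c ·ₚ f) _) ⟩
  (d ·ₚ g +ₚ c ·ₚ f) +ₚ shift (f *ₚ g) ≈⟨ +-cong (+-comm (d ·ₚ g) (c ·ₚ f)) ≈-refl ⟩
  (c ·ₚ f +ₚ d ·ₚ g) +ₚ shift (f *ₚ g) ≈⟨ +-assoc (c ·ₚ f) (d ·ₚ g) _ ⟩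
  c ·ₚ f +ₚ (d ·ₚ g +ₚ shift (f *ₚ g)) ∎)
  where
  open ≈-Reasoning
  d·c≈c·d : d ℤ.* c ℤ.+ + 0 ≡ c ℤ.* d ℤ.+ + 0
  d·c≈c·d = cong (ℤ._+ + 0) (ℤ.*-comm d c)

*-comm : ∀ f g → f *ₚ g ≈ g *ₚ f
*-comm []      g = ≈-sym (*-zeroʳ g)
*-comm (c ∷ f) g = ≈-trans (+-cong ≈-refl (shift-cong (*-comm f g))) (≈-sym (*-∷ʳ g c f))

*-congˡ : ∀ {f f′} g → f ≈ f′ → f *ₚ g ≈ f′ *ₚ g
*-congˡ {f} {f′} g e = ≈-trans (*-comm f g) (≈-trans (*-congʳ g e) (*-comm g f′))

*-cong : ∀ {f f′ g g′} → f ≈ f′ → g ≈ g′ → f *ₚ g ≈ f′ *ₚ g′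
*-cong {f′ = f′} {g} e e′ = ≈-trans (*-congˡ g e) (*-congʳ f′ e′)

*-distribˡ-+ : ∀ f g h → f *ₚ (g +ₚ h) ≈ f *ₚ g +ₚ f *ₚ h
*-distribˡ-+ []      g h = ≈-refl
*-distribˡ-+ (c ∷ f) g h = begin
  c ·ₚ (g +ₚ h) +ₚ shift (f *ₚ (g +ₚ h))
    ≈⟨ +-cong (·-distrib-+ c g h) (shift-cong (*-distribˡ-+ f g h)) ⟩
  (c ·ₚ g +ₚ c ·ₚ h) +ₚ (shift (f *ₚ g) +ₚ shift (f *ₚ h))
    ≈⟨ +-interchange (c ·ₚ g) (c ·ₚ h) (shift (f *ₚ g)) (shift (f *ₚ h)) ⟩
  (c ·ₚ g +ₚ shift (f *ₚ g)) +ₚ (c ·ₚ h +ₚ shift (f *ₚ h)) ∎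
  where open ≈-Reasoning

*-distribʳ-+ : ∀ h f g → (f +ₚ g) *ₚ h ≈ f *ₚ h +ₚ g *ₚ h
*-distribʳ-+ h f g = ≈-trans (*-comm (f +ₚ g) h)
  (≈-trans (*-distribˡ-+ h f g) (+-cong (*-comm h f) (*-comm h g)))

·-*-assoc : ∀ a f g → (a ·ₚ f) *ₚ g ≈ a ·ₚ (f *ₚ g)
·-*-assoc a []      g = ≈-refl
·-*-assoc a (c ∷ f) g = begin
  (a ℤ.* c) ·ₚ g +ₚ shift ((a ·ₚ f) *ₚ g)   ≈⟨ +-cong (≈-sym (·-assoc a c g)) (shift-cong (·-*-assoc a f g)) ⟩
  a ·ₚ (c ·ₚ g) +ₚ shift (a ·ₚ (f *ₚ g))    ≈⟨ +-cong ≈-refl (≈-sym (·-shift a (f *ₚ g))) ⟩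
  a ·ₚ (c ·ₚ g) +ₚ a ·ₚ shift (f *ₚ g)      ≈⟨ ≈-sym (·-distrib-+ a (c ·ₚ g) (shift (f *ₚ g))) ⟩
  a ·ₚ (c ·ₚ g +ₚ shift (f *ₚ g))           ∎
  where open ≈-Reasoning

shift-*-assoc : ∀ f g → shift f *ₚ g ≈ shift (f *ₚ g)
shift-*-assoc f g = +-cong (0·f≈0 g) ≈-refl

*-assoc : ∀ f g h → (f *ₚ g) *ₚ h ≈ f *ₚ (g *ₚ h)
*-assoc []      g h = ≈-refl
*-assoc (c ∷ f) g h = begin
  (c ·ₚ g +ₚ shift (f *ₚ g)) *ₚ h          ≈⟨ *-distribʳ-+ h (c ·ₚ g) (shift (f *ₚ g)) ⟩
  (c ·ₚ g) *ₚ h +ₚ shift (f *ₚ g) *ₚ h     ≈⟨ +-cong (·-*-assoc c g h) (shift-*-assoc (f *ₚ g) h) ⟩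
  c ·ₚ (g *ₚ h) +ₚ shift ((f *ₚ g) *ₚ h)   ≈⟨ +-cong ≈-refl (shift-cong (*-assoc f g h)) ⟩
  c ·ₚ (g *ₚ h) +ₚ shift (f *ₚ (g *ₚ h))   ∎
  where open ≈-Reasoning

*-identityˡ : ∀ f → oneₚ *ₚ f ≈ f
*-identityˡ f = ≈-trans (+-cong (1·f≈f f) shift-zero) (+-identityʳ f)

*-identityʳ : ∀ f → f *ₚ oneₚ ≈ f
*-identityʳ f = ≈-trans (*-comm f oneₚ) (*-identityˡ f)

polyRing : CommutativeRing _ _
polyRing = record
  { Carrier           = Poly
  ; _≈_               = _≈_
  ; _+_               = _+ₚ_
  ; _*_               = _*ₚ_
  ; -_                = negₚ
  ; 0#                = zeroₚ
  ; 1#                = oneₚ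
  ; isCommutativeRing = record
    { isRing = record
      { +-isAbelianGroup = record
        { isGroup = record
          { isMonoid = record
            { isSemigroup = record
              { isMagma = record { isEquivalence = ≈-isEquivalence ; ∙-cong = +-cong }
              ; assoc   = +-assoc }
            ; identity = +-identityˡ , +-identityʳ }
          ; inverse = +-inverseˡ , +-inverseʳ
          ; ⁻¹-cong = ·-cong (- + 1) }
        ; comm = +-comm }
      ; *-cong     = *-cong
      ; *-assoc    = *-assoc
      ; *-identity = *-identityˡ , *-identityʳ
      ; distrib    = *-distribˡ-+ , *-distribʳ-+ }
    ; *-comm = *-comm }
  }

open Congruence polyRing renaming (_∣_ to _∣ℤ[q]_)

-- Dilation q ↦ q^(k+1)

shifts : ℕ → Poly → Poly
shifts m f = replicate m (+ 0) ++ f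

shifts-cong : ∀ m {f g} → f ≈ g → shifts m f ≈ shifts m g
shifts-cong zero    e = e
shifts-cong (suc m) e = shift-cong (shifts-cong m e)

shifts-zero : ∀ m → shifts m zeroₚ ≈ zeroₚ
shifts-zero zero    = ≈-refl
shifts-zero (suc m) = ≈-trans (shift-cong (shifts-zero m)) shift-zero

shifts-+ : ∀ m f g → shifts m (f +ₚ g) ≈ shifts m f +ₚ shifts m g
shifts-+ zero    f g = ≈-refl
shifts-+ (suc m) f g = shift-cong (shifts-+ m f g)

shifts-· : ∀ m a f → a ·ₚ shifts m f ≈ shifts m (a ·ₚ f)
shifts-· zero    a f = ≈-refl
shifts-· (suc m) a f = ≈-trans (·-shift a (shifts m f)) (shift-cong (shifts-· m a f))

shifts-*-assoc : ∀ m f g → shifts m f *ₚ g ≈ shifts m (f *ₚ g)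
shifts-*-assoc zero    f g = ≈-refl
shifts-*-assoc (suc m) f g = ≈-trans (shift-*-assoc (shifts m f) g) (shift-cong (shifts-*-assoc m f g))

shifts-shifts : ∀ m m′ f → shifts m (shifts m′ f) ≈ shifts (m + m′) f
shifts-shifts zero    m′ f = ≈-refl
shifts-shifts (suc m) m′ f = shift-cong (shifts-shifts m m′ f)

dilate-∷ : ∀ k c f → dilate k (c ∷ f) ≈ c ∷ shifts k (dilate k f)
dilate-∷ k c []      = ∷-cong refl (≈-sym (shifts-zero k))
dilate-∷ k c (d ∷ f) = ≈-refl

dilate-≈0 : ∀ k {f} → f ≈ zeroₚ → dilate k f ≈ zeroₚ
dilate-≈0 k {[]}    e = ≈-refl
dilate-≈0 k {c ∷ f} e = begin
  dilate k (c ∷ f)              ≈⟨ dilate-∷ k c f ⟩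
  c ∷ shifts k (dilate k f)     ≈⟨ ∷-cong (coeff-≡ e 0) (shifts-cong k (dilate-≈0 k (mk≈ (coeff-≡ e ∘ suc)))) ⟩
  shift (shifts k [])           ≈⟨ ≈-trans (shift-cong (shifts-zero k)) shift-zero ⟩
  []                            ∎
  where open ≈-Reasoning

dilate-cong : ∀ k {f g} → f ≈ g → dilate k f ≈ dilate k g
dilate-cong k {[]}    {g}     e = ≈-sym (dilate-≈0 k (≈-sym e))
dilate-cong k {c ∷ f} {[]}    e = dilate-≈0 k e
dilate-cong k {c ∷ f} {d ∷ g} e = begin
  dilate k (c ∷ f)           ≈⟨ dilate-∷ k c f ⟩
  c ∷ shifts k (dilate k f)  ≈⟨ ∷-cong (coeff-≡ e 0) (shifts-cong k (dilate-cong k (tail-≈ e))) ⟩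
  d ∷ shifts k (dilate k g)  ≈⟨ ≈-sym (dilate-∷ k d g) ⟩
  dilate k (d ∷ g)           ∎
  where open ≈-Reasoning

dilate-+ : ∀ k f g → dilate k (f +ₚ g) ≈ dilate k f +ₚ dilate k g
dilate-+ k []      g       = ≈-refl
dilate-+ k (c ∷ f) []      = ≈-sym (+-identityʳ (dilate k (c ∷ f)))
dilate-+ k (c ∷ f) (d ∷ g) = begin
  dilate k ((c ℤ.+ d) ∷ (f +ₚ g))                               ≈⟨ dilate-∷ k (c ℤ.+ d) (f +ₚ g) ⟩
  (c ℤ.+ d) ∷ shifts k (dilate k (f +ₚ g))                      ≈⟨ ∷-cong refl (shifts-cong k (dilate-+ k f g)) ⟩
  (c ℤ.+ d) ∷ shifts k (dilate k f +ₚ dilate k g)               ≈⟨ ∷-cong refl (shifts-+ k (dilate k f) (dilate k g)) ⟩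
  (c ∷ shifts k (dilate k f)) +ₚ (d ∷ shifts k (dilate k g))    ≈⟨ ≈-sym (+-cong (dilate-∷ k c f) (dilate-∷ k d g)) ⟩
  dilate k (c ∷ f) +ₚ dilate k (d ∷ g)                          ∎
  where open ≈-Reasoning

dilate-· : ∀ k a f → dilate k (a ·ₚ f) ≈ a ·ₚ dilate k f
dilate-· k a []      = ≈-refl
dilate-· k a (c ∷ f) = begin
  dilate k ((a ℤ.* c) ∷ a ·ₚ f)               ≈⟨ dilate-∷ k (a ℤ.* c) (a ·ₚ f) ⟩
  (a ℤ.* c) ∷ shifts k (dilate k (a ·ₚ f))    ≈⟨ ∷-cong refl (shifts-cong k (dilate-· k a f)) ⟩
  (a ℤ.* c) ∷ shifts k (a ·ₚ dilate k f)      ≈⟨ ∷-cong refl (≈-sym (shifts-· k a (dilate k f))) ⟩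
  a ·ₚ (c ∷ shifts k (dilate k f))            ≈⟨ ·-cong a (≈-sym (dilate-∷ k c f)) ⟩
  a ·ₚ dilate k (c ∷ f)                       ∎
  where open ≈-Reasoning

dilate-shift : ∀ k f → dilate k (shift f) ≈ shifts (suc k) (dilate k f)
dilate-shift k f = dilate-∷ k (+ 0) f

dilate-* : ∀ k f g → dilate k (f *ₚ g) ≈ dilate k f *ₚ dilate k g
dilate-* k []      g = ≈-refl
dilate-* k (c ∷ f) g = begin
  dilate k (c ·ₚ g +ₚ shift (f *ₚ g))
    ≈⟨ dilate-+ k (c ·ₚ g) (shift (f *ₚ g)) ⟩
  dilate k (c ·ₚ g) +ₚ dilate k (shift (f *ₚ g))
    ≈⟨ +-cong (dilate-· k c g) (dilate-shift k (f *ₚ g)) ⟩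
  c ·ₚ dilate k g +ₚ shift (shifts k (dilate k (f *ₚ g)))
    ≈⟨ +-cong ≈-refl (shift-cong (shifts-cong k (dilate-* k f g))) ⟩
  c ·ₚ dilate k g +ₚ shift (shifts k (dilate k f *ₚ dilate k g))
    ≈⟨ +-cong ≈-refl (shift-cong (≈-sym (shifts-*-assoc k (dilate k f) (dilate k g)))) ⟩
  (c ∷ shifts k (dilate k f)) *ₚ dilate k g
    ≈⟨ *-congˡ (dilate k g) (≈-sym (dilate-∷ k c f)) ⟩
  dilate k (c ∷ f) *ₚ dilate k g ∎
  where open ≈-Reasoning

dilate-shifts : ∀ k m f → dilate k (shifts m f) ≈ shifts (m * suc k) (dilate k f)
dilate-shifts k zero    f = ≈-refl
dilate-shifts k (suc m) f = begin
  dilate k (shift (shifts m f))                      ≈⟨ dilate-shift k (shifts m f) ⟩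
  shifts (suc k) (dilate k (shifts m f))             ≈⟨ shifts-cong (suc k) (dilate-shifts k m f) ⟩
  shifts (suc k) (shifts (m * suc k) (dilate k f))   ≈⟨ shifts-shifts (suc k) (m * suc k) (dilate k f) ⟩
  shifts (suc k + m * suc k) (dilate k f)            ∎
  where open ≈-Reasoning

-- divisorsPred and dilate encode a positive number d by d - 1; in this encoding
-- j ⊛ k is the product, as suc (j ⊛ k) = suc j * suc k holds by definition.
infixl 7 _⊛_
_⊛_ : ℕ → ℕ → ℕ
j ⊛ k = k + j * suc k

⊛-comm : ∀ j k → j ⊛ k ≡ k ⊛ j
⊛-comm j k = cong ℕ.pred (ℕ.*-comm (suc j) (suc k))

dilate-dilate : ∀ j k f → dilate j (dilate k f) ≈ dilate (j ⊛ k) f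
dilate-dilate j k []      = ≈-refl
dilate-dilate j k (c ∷ f) = begin
  dilate j (dilate k (c ∷ f))                            ≈⟨ dilate-cong j (dilate-∷ k c f) ⟩
  dilate j (c ∷ shifts k (dilate k f))                   ≈⟨ dilate-∷ j c _ ⟩
  c ∷ shifts j (dilate j (shifts k (dilate k f)))        ≈⟨ ∷-cong refl (shifts-cong j (dilate-shifts j k (dilate k f))) ⟩
  c ∷ shifts j (shifts (k * suc j) (dilate j (dilate k f))) ≈⟨ ∷-cong refl (shifts-shifts j (k * suc j) _) ⟩
  c ∷ shifts (k ⊛ j) (dilate j (dilate k f))            ≈⟨ ∷-cong refl (shifts-cong _ (dilate-dilate j k f)) ⟩
  c ∷ shifts (k ⊛ j) (dilate (j ⊛ k) f)                 ≡⟨ cong (λ i → c ∷ shifts i (dilate (j ⊛ k) f)) (⊛-comm k j) ⟩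
  c ∷ shifts (j ⊛ k) (dilate (j ⊛ k) f)                 ≈⟨ ≈-sym (dilate-∷ (j ⊛ k) c f) ⟩
  dilate (j ⊛ k) (c ∷ f)                                ∎
  where open ≈-Reasoning

dilate-0 : ∀ f → dilate 0 f ≈ f
dilate-0 []      = ≈-refl
dilate-0 (c ∷ f) = ≈-trans (dilate-∷ 0 c f) (∷-cong refl (dilate-0 f))

-- q-integers

*-shifts : ∀ m f g → f *ₚ shifts m g ≈ shifts m (f *ₚ g)
*-shifts m f g = ≈-trans (*-comm f (shifts m g)) (≈-trans (shifts-*-assoc m g f) (shifts-cong m (*-comm g f)))

qInt-+ : ∀ a b → qInt (a + b) ≈ qInt a +ₚ shifts a (qInt b)
qInt-+ zero    b = ≈-refl
qInt-+ (suc a) b = ∷-cong refl (qInt-+ a b)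

qInt-* : ∀ u r → qInt (suc u * r) ≈ qInt (suc u) *ₚ dilate u (qInt r)
qInt-* u zero    rewrite ℕ.*-zeroʳ u = ≈-sym (*-zeroʳ (qInt (suc u)))
qInt-* u (suc r) = begin
  qInt (suc u * suc r)                          ≡⟨ cong qInt (ℕ.*-suc (suc u) r) ⟩
  qInt (suc u + suc u * r)                      ≈⟨ qInt-+ (suc u) (suc u * r) ⟩
  Q +ₚ shifts (suc u) (qInt (suc u * r))        ≈⟨ +-cong (≈-refl {Q}) (shifts-cong (suc u) (qInt-* u r)) ⟩
  Q +ₚ shifts (suc u) (Q *ₚ D)                  ≈⟨ +-cong (≈-sym (*-identityʳ Q)) (≈-sym (*-shifts (suc u) Q D)) ⟩
  Q *ₚ oneₚ +ₚ Q *ₚ shifts (suc u) D            ≈⟨ ≈-sym (*-distribˡ-+ Q oneₚ (shifts (suc u) D)) ⟩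
  Q *ₚ (+ 1 ∷ shifts u D)                       ≈⟨ *-congʳ Q (≈-sym (dilate-∷ u (+ 1) (qInt r))) ⟩
  Q *ₚ dilate u (qInt (suc r))                  ∎
  where
  open ≈-Reasoning
  Q = qInt (suc u)
  D = dilate u (qInt r)

qInt∣qInt-* : ∀ m r → qInt m ∣ℤ[q] qInt (r * m)
qInt∣qInt-* zero    r rewrite ℕ.*-zeroʳ r = zeroₚ , ≈-refl
qInt∣qInt-* (suc u) r = dilate u (qInt r) , ≈-trans (*-comm _ (qInt (suc u)))
  (≈-trans (≈-sym (qInt-* u r)) (≡⇒≈ (cong qInt (ℕ.*-comm (suc u) r))))

∣-shifts : ∀ {M} m {f} → M ∣ℤ[q] f → M ∣ℤ[q] shifts m f
∣-shifts {M} m {f} M∣f = ∣ʳ-respʳ-≈ qᵐf≈shifts (x∣ʳy⇒x∣ʳzy (shifts m oneₚ) M∣f)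
  where
  qᵐf≈shifts : shifts m oneₚ *ₚ f ≈ shifts m f
  qᵐf≈shifts = ≈-trans (shifts-*-assoc m oneₚ f) (shifts-cong m (*-identityˡ f))

dilate-≡-mod : ∀ k {m f g} → f ≡ g [mod m ] → dilate k f ≡ dilate k g [mod dilate k m ]
dilate-≡-mod k {m} {f} {g} (≡-mod (h , h*m≈f-g)) = ≡-mod (dilate k h , (begin
  dilate k h *ₚ dilate k m         ≈⟨ ≈-sym (dilate-* k h m) ⟩
  dilate k (h *ₚ m)                ≈⟨ dilate-cong k h*m≈f-g ⟩
  dilate k (f -ₚ g)                ≈⟨ dilate-+ k f (negₚ g) ⟩
  dilate k f +ₚ dilate k (negₚ g)  ≈⟨ +-cong ≈-refl (dilate-· k (- + 1) g) ⟩
  dilate k f -ₚ dilate k g         ∎))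
  where open ≈-Reasoning

module _ {M F : Poly} where

  private
    ∣qInt*F-multiple : ∀ {m} r → M ∣ℤ[q] qInt m *ₚ F → M ∣ℤ[q] qInt (r * m) *ₚ F
    ∣qInt*F-multiple {m} r M∣[m]F with qInt∣qInt-* m r
    ... | h , h*[m]≈[rm] = ∣ʳ-respʳ-≈ (≈-trans (≈-sym (*-assoc h (qInt m) F)) (*-congˡ F h*[m]≈[rm]))
                                      (x∣ʳy⇒x∣ʳzy h M∣[m]F)

    ∣qInt*F-difference : ∀ d k → M ∣ℤ[q] qInt (d + k) *ₚ F → M ∣ℤ[q] qInt k *ₚ F → M ∣ℤ[q] qInt d *ₚ F
    ∣qInt*F-difference d k M∣[d+k]F M∣[k]F = ∣-+-cancelˡ (∣ʳ-respʳ-≈ split M∣[d+k]F) (∣-shifts d M∣[k]F)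
      where
      open ≈-Reasoning
      split : qInt (d + k) *ₚ F ≈ shifts d (qInt k *ₚ F) +ₚ qInt d *ₚ F
      split = begin
        qInt (d + k) *ₚ F                      ≈⟨ *-congˡ F (qInt-+ d k) ⟩
        (qInt d +ₚ shifts d (qInt k)) *ₚ F     ≈⟨ *-distribʳ-+ F (qInt d) (shifts d (qInt k)) ⟩
        qInt d *ₚ F +ₚ shifts d (qInt k) *ₚ F  ≈⟨ +-comm (qInt d *ₚ F) (shifts d (qInt k) *ₚ F) ⟩
        shifts d (qInt k) *ₚ F +ₚ qInt d *ₚ F  ≈⟨ +-cong (shifts-*-assoc d (qInt k) F) (≈-refl {qInt d *ₚ F}) ⟩
        shifts d (qInt k *ₚ F) +ₚ qInt d *ₚ F  ∎

  -- Bézout: d + y w = x u gives [x u] = [d] + q^d [y w], and similarly with u, w swapped.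
  ∣qInt*F-gcd : ∀ u w → M ∣ℤ[q] qInt u *ₚ F → M ∣ℤ[q] qInt w *ₚ F → M ∣ℤ[q] qInt (gcd u w) *ₚ F
  ∣qInt*F-gcd u w M∣[u]F M∣[w]F with Bézout.identity (gcd-GCD u w)
  ... | Bézout.+- x y d+yw≡xu = ∣qInt*F-difference (gcd u w) (y * w)
          (subst (λ n → M ∣ℤ[q] qInt n *ₚ F) (sym d+yw≡xu) (∣qInt*F-multiple x M∣[u]F))
          (∣qInt*F-multiple y M∣[w]F)
  ... | Bézout.-+ x y d+xu≡yw = ∣qInt*F-difference (gcd u w) (x * u)
          (subst (λ n → M ∣ℤ[q] qInt n *ₚ F) (sym d+xu≡yw) (∣qInt*F-multiple y M∣[w]F))
          (∣qInt*F-multiple x M∣[u]F)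

-- Primes, gcd descent and the Möbius function

∃-prime-divisor : ∀ n → .{{NonZero n}} → n ≢ 1 → ∃[ p ] Prime p × p ∣ n
∃-prime-divisor n n≢1 with factorise n
... | record { factors = []     ; isFactorisation = n≡1 } = ⊥-elim (n≢1 n≡1)
... | record { factors = p ∷ ps ; isFactorisation = n≡Π ; factorsPrime = pp ∷ _ } =
  p , pp , subst (p ∣_) (sym n≡Π) (m∣m*n _)

prime-∤⇒coprime : ∀ {p m} → Prime p → ¬ p ∣ m → Coprime m p
prime-∤⇒coprime pp p∤m (i∣m , i∣p) with prime⇒irreducible pp i∣p
... | inj₁ i≡1    = i≡1
... | inj₂ refl   = ⊥-elim (p∤m i∣m)

∤⇒nonZero : ∀ {p m} → ¬ p ∣ m → NonZero m
∤⇒nonZero {p} {zero}  p∤0 = ⊥-elim (p∤0 (p ∣0))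
∤⇒nonZero {p} {suc m} _   = _

p-adic-split : ∀ {p} → Prime p → ∀ n → .{{NonZero n}} → ∃₂ λ v m → ¬ p ∣ m × p ^ v * m ≡ n
p-adic-split {p} pp = <-rec (λ n → .{{NonZero n}} → ∃₂ λ v m → ¬ p ∣ m × p ^ v * m ≡ n) split
  where
  instance
    _ = prime⇒nonZero pp
    _ = prime⇒nonTrivial pp
  split : ∀ n → (∀ {n′} → n′ < n → .{{NonZero n′}} → ∃₂ λ v m → ¬ p ∣ m × p ^ v * m ≡ n′) →
          .{{NonZero n}} → ∃₂ λ v m → ¬ p ∣ m × p ^ v * m ≡ n
  split n rec with p ∣? n
  ... | no  p∤n = 0 , n , p∤n , ℕ.*-identityˡ n
  ... | yes p∣n with rec (quotient-< p∣n) {{quotient≢0 p∣n}}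
  ...   | v , m , p∤m , pᵛm≡n/p = suc v , m , p∤m , (begin
    p * p ^ v * m        ≡⟨ ℕ.*-assoc p (p ^ v) m ⟩
    p * (p ^ v * m)      ≡⟨ cong (p *_) pᵛm≡n/p ⟩
    p * quotient p∣n     ≡⟨ sym (m∣n⇒n≡m*quotient p∣n) ⟩
    n                    ∎)
    where open ≡-Reasoning

module _ {ℓ} {P : ℕ → Set ℓ}
         (P-gcd : ∀ u w → P u → P w → P (gcd u w))
         (P-avoids : ∀ p → Prime p → ∃[ m ] ¬ p ∣ m × P m) where

  gcd-closed⇒1 : ∀ n → .{{NonZero n}} → P n → P 1
  gcd-closed⇒1 = <-rec (λ n → .{{NonZero n}} → P n → P 1) descend
    where
    descend : ∀ n → (∀ {c} → c < n → .{{NonZero c}} → P c → P 1) → .{{NonZero n}} → P n → P 1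
    descend 1 _ P1 = P1
    descend n@(suc (suc _)) rec Pn with ∃-prime-divisor n (λ ())
    ... | p , pp , p∣n with P-avoids p pp
    ...   | m , p∤m , Pm = rec c<n {{c≢0}} (P-gcd n m Pn Pm)
      where
      c = gcd n m
      c≢0 : NonZero c
      c≢0 = ℕ.≢-nonZero (gcd[m,n]≢0 n m (inj₁ (λ ())))
      c<n : c < n
      c<n = ℕ.≤∧≢⇒< (∣⇒≤ (gcd[m,n]∣m n m))
                     λ c≡n → p∤m (∣-trans (subst (p ∣_) (sym c≡n) p∣n) (gcd[m,n]∣n n m))

unique-↭ : ∀ {A : Set} {xs ys : List A} → Unique xs → Unique ys → (∀ {x} → x ∈ xs ⇔ x ∈ ys) → xs ↭ ys
unique-↭ xs! ys! xs⇔ys = ∼bag⇒↭ (unique∧set⇒bag xs! ys! xs⇔ys)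

∈-primeDivisors⁻ : ∀ {n p} → p ∈ primeDivisors n → Prime p × p ∣ n
∈-primeDivisors⁻ {n} p∈ = proj₂ (∈-filter⁻ (λ p → prime? p ×-dec (p ∣? n)) {xs = upTo (suc n)} p∈)

∈-primeDivisors⁺ : ∀ {n p} → .{{NonZero n}} → Prime p → p ∣ n → p ∈ primeDivisors n
∈-primeDivisors⁺ {n} pp p∣n =
  ∈-filter⁺ (λ p → prime? p ×-dec (p ∣? n)) (∈-upTo⁺ (s≤s (∣⇒≤ p∣n))) (pp , p∣n)

primeDivisors-unique : ∀ n → Unique (primeDivisors n)
primeDivisors-unique n = Unique.filter⁺ (λ p → prime? p ×-dec (p ∣? n)) (Unique.upTo⁺ (suc n))

SquareFree : ℕ → Set
SquareFree n = ∀ {r} → Prime r → ¬ r * r ∣ n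

private
  squarefreeFold : ℕ → List ℕ → Bool
  squarefreeFold n = foldr (λ p b → does (¬? ((p * p) ∣? n)) ∧ b) true

  squarefreeFold⇒All : ∀ n xs → squarefreeFold n xs ≡ true → All (λ p → ¬ p * p ∣ n) xs
  squarefreeFold⇒All n []       _ = []
  squarefreeFold⇒All n (x ∷ xs) e with (x * x) ∣? n
  ... | no ¬x²∣n = ¬x²∣n ∷ squarefreeFold⇒All n xs e

  All⇒squarefreeFold : ∀ n {xs} → All (λ p → ¬ p * p ∣ n) xs → squarefreeFold n xs ≡ true
  All⇒squarefreeFold n []                      = refl
  All⇒squarefreeFold n {x ∷ xs} (¬x²∣n ∷ rest) with (x * x) ∣? n
  ... | yes x²∣n = ⊥-elim (¬x²∣n x²∣n)
  ... | no _     = All⇒squarefreeFold n rest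

squarefree⇒SquareFree : ∀ {n} → .{{NonZero n}} → squarefree n ≡ true → SquareFree n
squarefree⇒SquareFree {n} sq {r} pr r²∣n =
  All.lookup (squarefreeFold⇒All n (primeDivisors n) sq) (∈-primeDivisors⁺ pr (m*n∣⇒m∣ r r r²∣n)) r²∣n

SquareFree⇒squarefree : ∀ {n} → SquareFree n → squarefree n ≡ true
SquareFree⇒squarefree {n} sf =
  All⇒squarefreeFold n (All.tabulate λ p∈ → sf (proj₁ (∈-primeDivisors⁻ {n} p∈)))

μ-SquareFree : ∀ {n} → SquareFree n → μ n ≡ negOnePow (length (primeDivisors n))
μ-SquareFree {n} sf rewrite SquareFree⇒squarefree sf = refl

μ-¬SquareFree : ∀ {n} → .{{NonZero n}} → ¬ SquareFree n → μ n ≡ + 0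
μ-¬SquareFree {n} ¬sf with squarefree n in sq
... | true  = ⊥-elim (¬sf (squarefree⇒SquareFree sq))
... | false = refl

μ-square : ∀ {p d} → .{{NonZero d}} → Prime p → p * p ∣ d → μ d ≡ + 0
μ-square pp p²∣d = μ-¬SquareFree λ sf → sf pp p²∣d

prime∣prime⇒≡ : ∀ {p r} → Prime p → Prime r → p ∣ r → p ≡ r
prime∣prime⇒≡ pp pr p∣r with prime⇒irreducible pr p∣r
... | inj₁ refl = ⊥-elim (ℕ.NonTrivial.nonTrivial (prime⇒nonTrivial pp))
... | inj₂ p≡r  = p≡r

SquareFree-∣ : ∀ {d n} → d ∣ n → SquareFree n → SquareFree d
SquareFree-∣ d∣n sf pr r²∣d = sf pr (∣-trans r²∣d d∣n)

SquareFree-*-prime : ∀ {p e} → Prime p → ¬ p ∣ e → SquareFree e → SquareFree (p * e)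
SquareFree-*-prime {p} {e} pp p∤e sf {r} pr r²∣pe with p ∣? r * r
... | no  p∤r² = sf pr (coprime-divisor (prime-∤⇒coprime pp p∤r²) r²∣pe)
... | yes p∣r² = p∤e (*-cancelˡ-∣ p (subst (λ x → x * x ∣ p * e) (sym p≡r) r²∣pe))
  where
  instance _ = prime⇒nonZero pp
  p≡r : p ≡ r
  p≡r = prime∣prime⇒≡ pp pr (reduce (euclidsLemma r r pp p∣r²))

primeDivisors-*-prime : ∀ {p e} → .{{NonZero e}} → Prime p → ¬ p ∣ e →
                        primeDivisors (p * e) ↭ p ∷ primeDivisors e
primeDivisors-*-prime {p} {e} pp p∤e =
  unique-↭ (primeDivisors-unique (p * e)) (p∉ ∷ primeDivisors-unique e) (mk⇔ to from)
  where
  instance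
    _ = prime⇒nonZero pp
    _ = ℕ.m*n≢0 p e
  p∉ : All (p ≢_) (primeDivisors e)
  p∉ = All.tabulate λ x∈ p≡x → p∤e (subst (_∣ e) (sym p≡x) (proj₂ (∈-primeDivisors⁻ {e} x∈)))
  to : ∀ {x} → x ∈ primeDivisors (p * e) → x ∈ p ∷ primeDivisors e
  to {x} x∈ with ∈-primeDivisors⁻ {p * e} x∈
  ... | px , x∣pe with euclidsLemma p e px x∣pe
  ...   | inj₁ x∣p = here (prime∣prime⇒≡ px pp x∣p)
  ...   | inj₂ x∣e = there (∈-primeDivisors⁺ px x∣e)
  from : ∀ {x} → x ∈ p ∷ primeDivisors e → x ∈ primeDivisors (p * e)
  from (here refl) = ∈-primeDivisors⁺ pp (m∣m*n e)
  from (there x∈)  with ∈-primeDivisors⁻ {e} x∈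
  ... | px , x∣e = ∈-primeDivisors⁺ px (∣n⇒∣m*n p x∣e)

SquareFree? : ∀ n → .{{NonZero n}} → Dec (SquareFree n)
SquareFree? n with squarefree n in sq
... | true  = yes (squarefree⇒SquareFree sq)
... | false = no λ sf → case trans (sym sq) (SquareFree⇒squarefree sf) of λ ()

μ-*-prime : ∀ {p e} → .{{NonZero e}} → Prime p → ¬ p ∣ e → μ (p * e) ≡ - μ e
μ-*-prime {p} {e} pp p∤e with SquareFree? e
... | yes sf = begin
  μ (p * e)                                     ≡⟨ μ-SquareFree (SquareFree-*-prime pp p∤e sf) ⟩
  negOnePow (length (primeDivisors (p * e)))    ≡⟨ cong negOnePow (↭-length (primeDivisors-*-prime pp p∤e)) ⟩
  - negOnePow (length (primeDivisors e))        ≡⟨ cong -_ (μ-SquareFree sf) ⟨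
  - μ e                                         ∎
  where open ≡-Reasoning
... | no ¬sf = trans (μ-¬SquareFree {p * e} (¬sf ∘ SquareFree-∣ (n∣m*n p))) (cong -_ (sym (μ-¬SquareFree ¬sf)))
  where instance _ = ℕ.m*n≢0 p e {{prime⇒nonZero pp}}

⊛-injective : ∀ j {a b} → j ⊛ a ≡ j ⊛ b → a ≡ b
⊛-injective j {a} {b} eq = ℕ.suc-injective (ℕ.*-cancelˡ-≡ (suc a) (suc b) (suc j) (cong suc eq))

∤∧∣pᵛ*m⇒∣m : ∀ {p d} → Prime p → ¬ p ∣ d → ∀ v {m} → d ∣ p ^ v * m → d ∣ m
∤∧∣pᵛ*m⇒∣m {d = d} pp p∤d zero {m} d∣m = subst (d ∣_) (ℕ.*-identityˡ m) d∣m
∤∧∣pᵛ*m⇒∣m {p} {d} pp p∤d (suc v) {m} d∣pᵛ⁺¹m =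
  ∤∧∣pᵛ*m⇒∣m pp p∤d v
    (coprime-divisor (prime-∤⇒coprime pp p∤d) (subst (d ∣_) (ℕ.*-assoc p (p ^ v) m) d∣pᵛ⁺¹m))

-- Divisors of p^(w+1) m

divisorsWith : {Q : Pred ℤ 0ℓ} → Decidable Q → ℕ → List ℕ
divisorsWith Q? n = filter (Q? ∘ μ ∘ suc) (divisorsPred n)

module _ {Q : Pred ℤ 0ℓ} (Q? : Decidable Q) where

  ∈-divisorsWith⁻ : ∀ {n k} → k ∈ divisorsWith Q? n → suc k ∣ n × Q (μ (suc k))
  ∈-divisorsWith⁻ {n} k∈ with ∈-filter⁻ (Q? ∘ μ ∘ suc) {xs = divisorsPred n} k∈
  ... | k∈D , Qμk = proj₂ (∈-filter⁻ (λ k → suc k ∣? n) {xs = upTo n} k∈D) , Qμk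

  ∈-divisorsWith⁺ : ∀ {n k} → .{{NonZero n}} → suc k ∣ n → Q (μ (suc k)) → k ∈ divisorsWith Q? n
  ∈-divisorsWith⁺ {n} k+1∣n Qμk =
    ∈-filter⁺ (Q? ∘ μ ∘ suc) (∈-filter⁺ (λ k → suc k ∣? n) (∈-upTo⁺ (∣⇒≤ k+1∣n)) k+1∣n) Qμk

  divisorsWith-unique : ∀ n → Unique (divisorsWith Q? n)
  divisorsWith-unique n = Unique.filter⁺ (Q? ∘ μ ∘ suc) (Unique.filter⁺ (λ k → suc k ∣? n) (Unique.upTo⁺ n))

module _ {p′ : ℕ} (pp : Prime (suc p′)) (w : ℕ) {m : ℕ} (p∤m : ¬ suc p′ ∣ m)
         {Q : Pred ℤ 0ℓ} (Q? : Decidable Q) (¬Q0 : ¬ Q (+ 0)) where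

  private
    p = suc p′
    N = p ^ suc w * m
    instance
      _ = prime⇒nonZero pp
      m≢0 : NonZero m
      m≢0 = ∤⇒nonZero p∤m
      N≢0 : NonZero N
      N≢0 = ℕ.m*n≢0 (p ^ suc w) m {{ℕ.m^n≢0 p (suc w)}}

    D[m] = divisorsWith Q? m
    D⁻[m] = divisorsWith (Q? ∘ -_) m

    N≡p*pʷm : N ≡ p * (p ^ w * m)
    N≡p*pʷm = ℕ.*-assoc p (p ^ w) m

    ∈-p⊛ : ∀ {k} → k ∈ map (p′ ⊛_) D⁻[m] → ∃[ j ] j ∈ D⁻[m] × k ≡ p′ ⊛ j
    ∈-p⊛ = ∈-map⁻ (p′ ⊛_)

    disjoint : ∀ {k} → ¬ (k ∈ D[m] × k ∈ map (p′ ⊛_) D⁻[m])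
    disjoint (k∈ , k∈′) with ∈-p⊛ k∈′
    ... | j , _ , refl = p∤m (∣-trans (m∣m*n (suc j)) (proj₁ (∈-divisorsWith⁻ Q? k∈)))

    to : ∀ {k} → k ∈ divisorsWith Q? N → k ∈ D[m] ++ map (p′ ⊛_) D⁻[m]
    to {k} k∈ with ∈-divisorsWith⁻ Q? {N} k∈ | p ∣? suc k
    ... | k+1∣N , Qμ | no p∤k+1 = ∈-++⁺ˡ (∈-divisorsWith⁺ Q? (∤∧∣pᵛ*m⇒∣m pp p∤k+1 (suc w) k+1∣N) Qμ)
    ... | k+1∣N , Qμ | yes (divides zero k+1≡0) with () ← k+1≡0
    ... | k+1∣N , Qμ | yes (divides (suc j) k+1≡e*p) =
      ∈-++⁺ʳ D[m] (subst (_∈ map (p′ ⊛_) D⁻[m]) (sym k≡p⊛j) (∈-map⁺ (p′ ⊛_) j∈))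
      where
      e = suc j
      k+1≡p*e : suc k ≡ p * e
      k+1≡p*e = trans k+1≡e*p (ℕ.*-comm e p)
      k≡p⊛j : k ≡ p′ ⊛ j
      k≡p⊛j = ℕ.suc-injective k+1≡p*e
      p∤e : ¬ p ∣ e
      p∤e p∣e = ¬Q0 (subst Q (μ-square pp (subst (p * p ∣_) (sym k+1≡p*e) (*-monoʳ-∣ p p∣e))) Qμ)
      e∣m : e ∣ m
      e∣m = ∤∧∣pᵛ*m⇒∣m pp p∤e w (*-cancelˡ-∣ p (subst₂ _∣_ k+1≡p*e N≡p*pʷm k+1∣N))
      j∈ : j ∈ D⁻[m]
      j∈ = ∈-divisorsWith⁺ (Q? ∘ -_) e∣m (subst Q (trans (cong μ k+1≡p*e) (μ-*-prime pp p∤e)) Qμ)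

    from : ∀ {k} → k ∈ D[m] ++ map (p′ ⊛_) D⁻[m] → k ∈ divisorsWith Q? N
    from {k} k∈ with ∈-++⁻ D[m] k∈
    ... | inj₁ k∈D with ∈-divisorsWith⁻ Q? k∈D
    ...   | k+1∣m , Qμ = ∈-divisorsWith⁺ Q? (∣n⇒∣m*n (p ^ suc w) k+1∣m) Qμ
    from {k} k∈ | inj₂ k∈pD with ∈-p⊛ k∈pD
    ...   | j , j∈ , refl with ∈-divisorsWith⁻ (Q? ∘ -_) j∈
    ...     | j+1∣m , Q-μ = ∈-divisorsWith⁺ Q? p*[j+1]∣N (subst Q (sym μp[j+1]) Q-μ)
      where
      p*[j+1]∣N : p * suc j ∣ N
      p*[j+1]∣N = subst (p * suc j ∣_) (sym N≡p*pʷm) (*-monoʳ-∣ p (∣n⇒∣m*n (p ^ w) j+1∣m))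
      μp[j+1] : μ (p * suc j) ≡ - μ (suc j)
      μp[j+1] = μ-*-prime pp (λ p∣j+1 → p∤m (∣-trans p∣j+1 j+1∣m))

  divisorsWith-split : divisorsWith Q? (p ^ suc w * m) ↭ D[m] ++ map (p′ ⊛_) D⁻[m]
  divisorsWith-split = unique-↭ (divisorsWith-unique Q? N)
    (Unique.++⁺ (divisorsWith-unique Q? m) (Unique.map⁺ (⊛-injective p′) (divisorsWith-unique (Q? ∘ -_) m)) disjoint)
    (mk⇔ to from)

-- q-Gauss sequences

∣ₚ⇒∣ℤ[q] : ∀ {m f} → m ∣ₚ f → m ∣ℤ[q] f
∣ₚ⇒∣ℤ[q] {m} (h , m*h≈f) = h , ≈-trans (*-comm h m) (mk≈ m*h≈f)

∣ℤ[q]⇒∣ₚ : ∀ {m f} → m ∣ℤ[q] f → m ∣ₚ f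
∣ℤ[q]⇒∣ₚ {m} (h , h*m≈f) = h , coeff-≡ (≈-trans (*-comm m h) h*m≈f)

·≈cst* : ∀ c f → c ·ₚ f ≈ (c ∷ []) *ₚ f
·≈cst* c f = ≈-sym (≈-trans (+-cong (≈-refl {c ·ₚ f}) shift-zero) (+-identityʳ (c ·ₚ f)))

∣ℤ[q]-· : ∀ c {m f} → m ∣ℤ[q] f → m ∣ℤ[q] c ·ₚ f
∣ℤ[q]-· c {f = f} m∣f = ∣ʳ-respʳ-≈ (≈-sym (·≈cst* c f)) (x∣ʳy⇒x∣ʳzy (c ∷ []) m∣f)

·-distrib-- : ∀ c f g → c ·ₚ (f -ₚ g) ≈ c ·ₚ f +ₚ (- c) ·ₚ g
·-distrib-- c f g =
  ≈-trans (·-distrib-+ c f (negₚ g)) (+-cong (≈-refl {c ·ₚ f}) (≈-trans (·-assoc c (- + 1) g) c*-1≈-c))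
  where
  c*-1≈-c : (c ℤ.* - + 1) ·ₚ g ≈ (- c) ·ₚ g
  c*-1≈-c = ≡⇒≈ (cong (_·ₚ g) (trans (ℤ.*-comm c (- + 1)) (ℤ.-1*i≡-i c)))

nonZero? : (x : ℤ) → Dec (x ≢ + 0)
nonZero? x = ¬? (x ℤ.≟ + 0)

∑-·-filter-nonZero : ∀ {A : Set} (c : A → ℤ) (f : A → Poly) xs →
  ∑ (λ x → c x ·ₚ f x) xs ≈ ∑ (λ x → c x ·ₚ f x) (filter (nonZero? ∘ c) xs)
∑-·-filter-nonZero c f []       = ≈-refl
∑-·-filter-nonZero {A} c f (x ∷ xs) = by-cases (c x ℤ.≟ + 0)
  where
  open ≈-Reasoning
  g : A → Poly
  g x = c x ·ₚ f x
  IH = ∑-·-filter-nonZero c f xs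
  by-cases : Dec (c x ≡ + 0) → ∑ g (x ∷ xs) ≈ ∑ g (filter (nonZero? ∘ c) (x ∷ xs))
  by-cases (yes cx≡0) = begin
    g x +ₚ ∑ g xs
      ≈⟨ +-cong (≈-trans (≡⇒≈ (cong (_·ₚ f x) cx≡0)) (0·f≈0 (f x))) IH ⟩
    zeroₚ +ₚ ∑ g (filter (nonZero? ∘ c) xs)
      ≡⟨ cong (∑ g) (List.filter-reject (nonZero? ∘ c) (λ cx≢0 → cx≢0 cx≡0)) ⟨
    ∑ g (filter (nonZero? ∘ c) (x ∷ xs))     ∎
  by-cases (no cx≢0) = begin
    g x +ₚ ∑ g xs                            ≈⟨ +-cong (≈-refl {g x}) IH ⟩
    ∑ g (x ∷ filter (nonZero? ∘ c) xs)       ≡⟨ cong (∑ g) (List.filter-accept (nonZero? ∘ c) cx≢0) ⟨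
    ∑ g (filter (nonZero? ∘ c) (x ∷ xs))     ∎

module PrimePower {a : ℕ → Poly} (gauss : IsQGauss a) {p′ : ℕ} (pp : Prime (suc p′)) (w : ℕ) where

  private
    p = suc p′
    P = p ^ suc w
    instance
      _ = ℕ.m^n≢0 p (suc w)

  qIntP : ℕ → Poly
  qIntP m = dilate (ℕ.pred m) (qInt P)

  GaussCongruence : ℕ → Set
  GaussCongruence m = a (P * m) ≡ dilate p′ (a (p ^ w * m)) [mod qIntP m ]

  qInt[P*m]≈ : ∀ m → .{{NonZero m}} → qInt (P * m) ≈ qInt m *ₚ qIntP m
  qInt[P*m]≈ m@(suc m″) = ≈-trans (≡⇒≈ (cong qInt (ℕ.*-comm P m))) (qInt-* m″ P)

  term-divisor : ∀ {m m′ k} → m ≡ m′ * suc k → term a (P * m) k ≈ dilate k (a (P * m′))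
  term-divisor {m} {m′} {k} m≡ = ≡⇒≈ (cong (dilate k ∘ a) (begin
    P * m / suc k             ≡⟨ cong (λ x → P * x / suc k) m≡ ⟩
    P * (m′ * suc k) / suc k  ≡⟨ cong (_/ suc k) (ℕ.*-assoc P m′ (suc k)) ⟨
    P * m′ * suc k / suc k    ≡⟨ m*n/n≡m (P * m′) (suc k) ⟩
    P * m′                    ∎))
    where open ≡-Reasoning

  term-p-divisor : ∀ {m m′ k} → m ≡ m′ * suc k →
                   term a (P * m) (p′ ⊛ k) ≈ dilate k (dilate p′ (a (p ^ w * m′)))
  term-p-divisor {m} {m′} {k} m≡ =
    ≈-sym (≈-trans (dilate-dilate k p′ _) (≡⇒≈ (cong₂ (λ i x → dilate i (a x)) (⊛-comm k p′) (sym quotient≡))))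
    where
    open ≡-Reasoning
    quotient≡ : P * m / (p * suc k) ≡ p ^ w * m′
    quotient≡ = begin
      P * m / (p * suc k)                ≡⟨ cong (λ x → P * x / (p * suc k)) m≡ ⟩
      p * p ^ w * (m′ * suc k) / (p * suc k) ≡⟨ cong (_/ (p * suc k)) (rearrange p (p ^ w) m′ (suc k)) ⟩
      p ^ w * m′ * (p * suc k) / (p * suc k) ≡⟨ m*n/n≡m (p ^ w * m′) (p * suc k) ⟩
      p ^ w * m′                         ∎
      where
      rearrange : ∀ p x m k → p * x * (m * k) ≡ x * m * (p * k)
      rearrange = solve 4 (λ p x m k → p :* x :* (m :* k) := x :* m :* (p :* k)) refl
        where open +-*-Solver

  qIntP-dilate : ∀ {m m′ k} → .{{NonZero m′}} → m ≡ m′ * suc k → dilate k (qIntP m′) ≈ qIntP m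
  qIntP-dilate {m} {suc m‴} {k} m≡ =
    ≈-trans (dilate-dilate k m‴ (qInt P)) (≡⇒≈ (cong (λ i → dilate i (qInt P)) k⊛m‴≡pred-m))
    where
    k⊛m‴≡pred-m : k ⊛ m‴ ≡ ℕ.pred m
    k⊛m‴≡pred-m = cong ℕ.pred (trans (ℕ.*-comm (suc k) (suc m‴)) (sym m≡))

  term≡term-p⊛ : ∀ {m k} → ¬ p ∣ m → (k+1∣m : suc k ∣ m) → GaussCongruence (quotient k+1∣m) →
           term a (P * m) k ≡ term a (P * m) (p′ ⊛ k) [mod qIntP m ]
  term≡term-p⊛ {k = k} p∤m (divides m′ m≡) congruence =
    ≡-mod-respˡ (≈-sym (term-divisor {m′ = m′} m≡)) (≡-mod-respʳ (≈-sym (term-p-divisor {m′ = m′} m≡))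
      (≡-mod-∣ (∣ʳ-reflexive (≈-sym (qIntP-dilate {{m′≢0}} m≡))) (dilate-≡-mod k congruence)))
    where
    m′≢0 : NonZero m′
    m′≢0 = ℕ.≢-nonZero λ { refl → p∤m (subst (p ∣_) (sym m≡) (p ∣0)) }

  module _ {m : ℕ} (p∤m : ¬ p ∣ m) where

    private
      N = P * m
      t = term a N

    μ-p⊛ : ∀ {k} → suc k ∣ m → μ (suc (p′ ⊛ k)) ≡ - μ (suc k)
    μ-p⊛ k+1∣m = μ-*-prime pp (λ p∣k+1 → p∤m (∣-trans p∣k+1 k+1∣m))

    gaussSum-split : gaussSum a N ≈ ∑ (λ k → μ (suc k) ·ₚ (t k -ₚ t (p′ ⊛ k))) (divisorsWith nonZero? m)
    gaussSum-split = begin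
      ∑ g (divisorsPred N)                           ≈⟨ ∑-·-filter-nonZero (μ ∘ suc) t (divisorsPred N) ⟩
      ∑ g (divisorsWith nonZero? N)                  ≈⟨ ∑-↭ g (divisorsWith-split pp w p∤m nonZero? (λ 0≢0 → 0≢0 refl)) ⟩
      ∑ g (D′ ++ map (p′ ⊛_) D″)                     ≈⟨ ∑-++ g D′ (map (p′ ⊛_) D″) ⟩
      ∑ g D′ +ₚ ∑ g (map (p′ ⊛_) D″)                 ≡⟨ cong (∑ g D′ +ₚ_) (∑-map g (p′ ⊛_) D″) ⟩
      ∑ g D′ +ₚ ∑ (g ∘ (p′ ⊛_)) D″                   ≡⟨ cong (λ D → ∑ g D′ +ₚ ∑ (g ∘ (p′ ⊛_)) D) D″≡D′ ⟩
      ∑ g D′ +ₚ ∑ (g ∘ (p′ ⊛_)) D′                   ≈⟨ ∑-+ g (g ∘ (p′ ⊛_)) D′ ⟩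
      ∑ (λ k → g k +ₚ g (p′ ⊛ k)) D′                 ≈⟨ ∑-cong (All.tabulate (pair-difference ∘ ∈-D′⇒∣)) ⟩
      ∑ (λ k → μ (suc k) ·ₚ (t k -ₚ t (p′ ⊛ k))) D′  ∎
      where
      open ≈-Reasoning
      g : ℕ → Poly
      g k = μ (suc k) ·ₚ t k
      D′ = divisorsWith nonZero? m
      D″ = divisorsWith (nonZero? ∘ -_) m
      D″≡D′ : D″ ≡ D′
      D″≡D′ = List.filter-≐ (nonZero? ∘ -_ ∘ μ ∘ suc) (nonZero? ∘ μ ∘ suc)
        ( (λ -x≢0 x≡0 → -x≢0 (cong -_ x≡0))
        , (λ x≢0 -x≡0 → x≢0 (trans (sym (ℤ.neg-involutive _)) (cong -_ -x≡0))) )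
        (divisorsPred m)
      ∈-D′⇒∣ : ∀ {k} → k ∈ D′ → suc k ∣ m
      ∈-D′⇒∣ k∈ = proj₁ (∈-divisorsWith⁻ nonZero? k∈)
      pair-difference : ∀ {k} → suc k ∣ m → g k +ₚ g (p′ ⊛ k) ≈ μ (suc k) ·ₚ (t k -ₚ t (p′ ⊛ k))
      pair-difference {k} k+1∣m =
        ≈-trans (+-cong (≈-refl {g k}) (≡⇒≈ (cong (_·ₚ t (p′ ⊛ k)) (μ-p⊛ k+1∣m))))
                (≈-sym (·-distrib-- (μ (suc k)) (t k) (t (p′ ⊛ k))))

    qIntP∣gaussSum : qIntP m ∣ℤ[q] gaussSum a N
    qIntP∣gaussSum = ∣ʳ-trans (qInt m , ≈-sym (qInt[P*m]≈ m))
                              (∣ʳ-respʳ-≈ (+-identityʳ (gaussSum a N)) (∣ₚ⇒∣ℤ[q] (gauss N (ℕ.>-nonZero⁻¹ N))))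
      where instance _ = ∤⇒nonZero p∤m
                     _ = ℕ.m*n≢0 P m

  gauss-congruence : ∀ m → ¬ p ∣ m → GaussCongruence m
  gauss-congruence = <-rec (λ m → ¬ p ∣ m → GaussCongruence m) step
    where
    step : ∀ m → (∀ {m′} → m′ < m → ¬ p ∣ m′ → GaussCongruence m′) → ¬ p ∣ m → GaussCongruence m
    step zero       _   p∤0 = ⊥-elim (p∤0 (p ∣0))
    step m@(suc m″) rec p∤m =
      ≡-mod (∣ʳ-respʳ-≈ δ₀≈ (∣-+-cancelʳ (∣ʳ-respʳ-≈ gauss≈ (qIntP∣gaussSum p∤m)) qIntP∣rest))
      where
      N = P * m
      t = term a N
      δ : ℕ → Poly
      δ k = μ (suc k) ·ₚ (t k -ₚ t (p′ ⊛ k))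
      proper = filter (λ k → suc k ∣? m) (applyUpTo suc m″)
      rest = filter (nonZero? ∘ μ ∘ suc) proper
      D′≡0∷rest : divisorsWith nonZero? m ≡ 0 ∷ rest
      D′≡0∷rest = trans (cong (filter (nonZero? ∘ μ ∘ suc)) (List.filter-accept (λ k → suc k ∣? m) (1∣ m)))
                        (List.filter-accept (nonZero? ∘ μ ∘ suc) {xs = proper} (λ ()))
      gauss≈ : gaussSum a N ≈ δ 0 +ₚ ∑ δ rest
      gauss≈ = ≈-trans (gaussSum-split p∤m) (≡⇒≈ (cong (∑ δ) D′≡0∷rest))
      qIntP∣δ : ∀ {k} → k ∈ rest → qIntP m ∣ℤ[q] δ k
      qIntP∣δ {k} k∈
        with ∈-filter⁻ (λ k → suc k ∣? m) {xs = applyUpTo suc m″}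
                       (proj₁ (∈-filter⁻ (nonZero? ∘ μ ∘ suc) {xs = proper} k∈))
      ... | k∈applyUpTo , k+1∣m with ∈-applyUpTo⁻ suc k∈applyUpTo
      ...   | i , _ , refl = ∣ℤ[q]-· (μ (suc k)) (∣-difference (term≡term-p⊛ p∤m k+1∣m
                               (rec (quotient-< k+1∣m) (λ p∣m′ → p∤m (∣-trans p∣m′ (quotient-∣ k+1∣m))))))
      qIntP∣rest : qIntP m ∣ℤ[q] ∑ δ rest
      qIntP∣rest = ∣-∑ δ (All.tabulate qIntP∣δ)
      m≡m*1 : m ≡ m * 1
      m≡m*1 = sym (ℕ.*-identityʳ m)
      δ₀≈ : δ 0 ≈ a N -ₚ dilate p′ (a (p ^ w * m))
      δ₀≈ = ≈-trans (1·f≈f _) (+-cong (≈-trans (term-divisor m≡m*1) (dilate-0 _))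
                                      (·-cong (- + 1) (≈-trans (term-p-divisor m≡m*1) (dilate-0 _))))

  module _ {m : ℕ} (p∤m : ¬ p ∣ m) where

    private
      N = P * m
      t = term a N

      Dμ : ℤ → List ℕ
      Dμ s = divisorsWith (λ x → x ℤ.≟ s) m

    eulerProd-≡ : ∀ s → s ≢ + 0 → eulerProd s a N ≡ ∏ t (Dμ s) *ₚ ∏ t (Dμ (- s)) [mod qIntP m ]
    eulerProd-≡ s s≢0 =
      ≡-mod-respˡ (≈-sym split) (≡-mod-* (≡-mod-refl {x = ∏ t (Dμ s)}) (∏-≡-mod (t ∘ (p′ ⊛_)) t (All.tabulate p⊛-≡)))
      where
      open ≈-Reasoning
      Q? = λ x → x ℤ.≟ s
      D⁻ = divisorsWith (Q? ∘ -_) m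
      −s≡ : D⁻ ≡ Dμ (- s)
      −s≡ = List.filter-≐ (Q? ∘ -_ ∘ μ ∘ suc) (λ k → μ (suc k) ℤ.≟ - s)
        ( (λ -x≡s → trans (sym (ℤ.neg-involutive _)) (cong -_ -x≡s))
        , (λ x≡-s → trans (cong -_ x≡-s) (ℤ.neg-involutive s)) )
        (divisorsPred m)
      split : eulerProd s a N ≈ ∏ t (Dμ s) *ₚ ∏ (t ∘ (p′ ⊛_)) (Dμ (- s))
      split = begin
        ∏ t (divisorsWith Q? N)
          ≈⟨ ∏-↭ t (divisorsWith-split pp w p∤m Q? (λ 0≡s → s≢0 (sym 0≡s))) ⟩
        ∏ t (Dμ s ++ map (p′ ⊛_) D⁻)
          ≈⟨ ∏-++ t (Dμ s) (map (p′ ⊛_) D⁻) ⟩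
        ∏ t (Dμ s) *ₚ ∏ t (map (p′ ⊛_) D⁻)
          ≡⟨ cong (∏ t (Dμ s) *ₚ_) (trans (∏-map t (p′ ⊛_) D⁻) (cong (∏ (t ∘ (p′ ⊛_))) −s≡)) ⟩
        ∏ t (Dμ s) *ₚ ∏ (t ∘ (p′ ⊛_)) (Dμ (- s)) ∎
      p⊛-≡ : ∀ {k} → k ∈ Dμ (- s) → t (p′ ⊛ k) ≡ t k [mod qIntP m ]
      p⊛-≡ k∈ with k+1∣m ← proj₁ (∈-divisorsWith⁻ (λ x → x ℤ.≟ - s) k∈) =
        ≡-mod-sym (term≡term-p⊛ p∤m k+1∣m
          (gauss-congruence _ λ p∣m′ → p∤m (∣-trans p∣m′ (quotient-∣ k+1∣m))))

    euler-≡ : eulerProd (+ 1) a N ≡ eulerProd (- + 1) a N [mod qIntP m ]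
    euler-≡ = ≡-mod-trans (eulerProd-≡ (+ 1) (λ ()))
                (≡-mod-respˡ (*-comm (∏ t (Dμ (- + 1))) (∏ t (Dμ (+ 1))))
                  (≡-mod-sym (eulerProd-≡ (- + 1) (λ ()))))

    qInt∣qInt*euler : qInt N ∣ℤ[q] qInt m *ₚ (eulerProd (+ 1) a N -ₚ eulerProd (- + 1) a N)
    qInt∣qInt*euler =
      ∣ʳ-respˡ-≈ (≈-sym (qInt[P*m]≈ m {{∤⇒nonZero p∤m}})) (x∣y⇒zx∣zy (qInt m) (∣-difference euler-≡))

theorem5 : (a : ℕ → Poly) → IsQGauss a → IsQEulerGauss a
theorem5 a gauss n@(suc _) _ =
  ∣ℤ[q]⇒∣ₚ (∣ʳ-respʳ-≈ (*-identityˡ ΔE) (gcd-closed⇒1 (∣qInt*F-gcd {qInt n} {ΔE}) avoids n n∈I))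
  where
  [_]∣[_]·ΔE : ℕ → ℕ → Set
  [ N ]∣[ m ]·ΔE = qInt N ∣ℤ[q] qInt m *ₚ (eulerProd (+ 1) a N -ₚ eulerProd (- + 1) a N)
  ΔE = eulerProd (+ 1) a n -ₚ eulerProd (- + 1) a n
  I : ℕ → Set
  I m = [ n ]∣[ m ]·ΔE
  n∈I : I n
  n∈I = ∣ʳ-respʳ-≈ (*-comm ΔE (qInt n)) (x∣ʳyx (qInt n) ΔE)
  avoids : ∀ p → Prime p → ∃[ m ] ¬ p ∣ m × I m
  avoids (suc p′) pp with p-adic-split pp n
  ... | zero  , m , p∤m , 1*m≡n = m , p∤m , subst I (sym (trans (sym (ℕ.*-identityˡ m)) 1*m≡n)) n∈I
  ... | suc w , m , p∤m , N≡n   =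
    m , p∤m , subst (λ N → [ N ]∣[ m ]·ΔE) N≡n (PrimePower.qInt∣qInt*euler {a} gauss pp w p∤m)
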